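{- Let $G$ be an undirected graph with $n$ vertices, $T$ a DFS tree of $G$ rooted at the super root $r$, and $U$ a set of insertions. Let $M_0\subseteq V(T)$ be a set such that every connected component of $T$ minus $M_0$ has at most $\log n$ vertices, and let $M=\{x\in M_0: |T(x)|\ge\log n\}$. Consider one run of the algorithm BatchInsert (described below) on $T$ and $U$, and let $X$ be the set of vertices $x$ such that during this run a query $Q(T(x),u,v)$ is made (inside DFS, with current path $\mathit{path}(u,v)$) with $|T(x)|\ge\log n$ and $\mathit{path}(u,\mathit{par}(x))\cap M\neq\emptyset$. If $x_1,x_2\in X$, $x_1\neq x_2$, and $x_1$ is an ancestor of $x_2$ in $T$, then $\mathit{path}(x_1,x_2)\cap M\neq\emptyset$.
   Context: A DFS tree of an undirected graph is a rooted spanning tree in which every non-tree edge joins an ancestor and a descendant; $r$ is a super root adjacent to every vertex. $T(x)$ is the subtree rooted at $x$, $\mathit{par}(x)$ the parent, $\mathit{path}(x,y)$ the tree path. The query $Q(T(w),u,v)$ (for $u$ an ancestor of $v$) returns an edge $(y,z)$ of $G$ with $y\in\mathit{path}(u,v)$, $z\in T(w)$ and $y$ the highest vertex of $\mathit{path}(u,v)$ adjacent to $T(w)$, or Null if none exists. Algorithm BatchInsert$(T,U)$: add each inserted vertex $v$ to $T$ with $\mathit{par}(v)=r$; set $L(v)=\emptyset$ for all $v$; for each inserted edge $(a,b)$ add $b$ to $L(a)$ and $a$ to $L(b)$; all vertices unvisited; call DFS$(r)$. Procedure DFS$(v)$: let $u=v$; while $\mathit{par}(u)$ exists and is unvisited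 set $u=\mathit{par}(u)$. Mark $\mathit{path}(u,v)=(w_1=u,\dots,w_t=v)$ visited. For each $i\in[t]$: if $i\ne t$ set $\mathit{par}^*(w_i)=w_{i+1}$; for each child $x$ of $w_i$ in $T$ other than $w_{i+1}$ compute $(y,z)=Q(T(x),u,v)$ and, if not Null, add $z$ to $L(y)$. Then for $i=1,\dots,t$ and each $x\in L(w_i)$: if $x$ is unvisited, set $\mathit{par}^*(x)=w_i$ and call DFS$(x)$. -}

module Defs where

open import Data.Nat using (ℕ; zero; suc)
open import Data.Nat.Logarithm using (⌊log₂_⌋; ⌈log₂_⌉)
open import Data.Fin using (Fin)
import Data.Fin.Properties as FinP
open import Data.Bool using (Bool; true; false; _∨_; if_then_else_)
open import Data.List using (List; []; _∷_; _++_; map; filter; foldr)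
open import Data.Bool.ListAction using (any)
open import Data.List.Relation.Binary.Permutation.Propositional using (_↭_)
open import Data.Maybe using (Maybe; just; nothing)
import Data.Maybe.Properties as MaybeP
open import Data.Product using (Σ; _×_; _,_; proj₁; proj₂)
open import Data.Sum using (_⊎_)
open import Data.Empty using (⊥)
open import Data.Unit using (⊤)
open import Relation.Nullary using (¬_; Dec; yes; no; ¬?)
open import Relation.Nullary.Decidable using (⌊_⌋)
open import Relation.Binary.Definitions using (DecidableEquality)
open import Relation.Binary.PropositionalEquality using (_≡_; _≢_; refl; cong)
open import Relation.Binary.Construct.Closure.ReflexiveTransitive using (Star)
open import Function.Definitions using (Injective)
open import Data.List using (allFin)
open import Data.List.Membership.Propositional using (_∈_)

-- Vertices: the super root r, the n vertices of G, the k inserted vertices.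

data Vert (n k : ℕ) : Set where
  root : Vert n k
  old  : Fin n → Vert n k
  new  : Fin k → Vert n k

module _ {n k : ℕ} where

  _≟V_ : DecidableEquality (Vert n k)
  root  ≟V root  = yes refl
  root  ≟V old _ = no λ ()
  root  ≟V new _ = no λ ()
  old _ ≟V root  = no λ ()
  old i ≟V old j with i FinP.≟ j
  ... | yes refl = yes refl
  ... | no ¬p    = no λ { refl → ¬p refl }
  old _ ≟V new _ = no λ ()
  new _ ≟V root  = no λ ()
  new _ ≟V old _ = no λ ()
  new i ≟V new j with i FinP.≟ j
  ... | yes refl = yes refl
  ... | no ¬p    = no λ { refl → ¬p refl }

  allV : List (Vert n k)
  allV = root ∷ (map old (allFin n) ++ map new (allFin k))

  IsNew : Vert n k → Set
  IsNew (new _) = ⊤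
  IsNew _       = ⊥

-- Adj  : adjacency of the undirected graph G on its n vertices
--   parT : parent function of the DFS tree T (rooted at the super root)
--   ins  : inserted edges (the k inserted vertices are the 'new' vertices)

record Setup : Set₁ where
  field
    n k  : ℕ
    Adj  : Fin n → Fin n → Set
    parT : Fin n → Vert n k
    ins  : List (Vert n k × Vert n k)

module _ (S : Setup) where
  open Setup S

  V : Set
  V = Vert n k

  -- parent in the tree T after BatchInsert added each inserted vertex
  -- as a child of r
  par : V → Maybe V
  par root    = nothing
  par (old i) = just (parT i)
  par (new _) = just root

  -- Anc a b : a is an ancestor of b (inclusive), i.e. b ∈ T(a)
  data Anc (a : V) : V → Set where
    here  : Anc a a
    there : ∀ {b c} → par b ≡ just c → Anc a c → Anc a b

  -- edges of G together with the super root r adjacent to every vertex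
  E : V → V → Set
  E root    root    = ⊥
  E root    _       = ⊤
  E (old _) root    = ⊤
  E (new _) root    = ⊤
  E (old i) (old j) = Adj i j
  E (old _) (new _) = ⊥
  E (new _) (old _) = ⊥
  E (new _) (new _) = ⊥

  record IsDFSTree : Set where
    field
      spanning   : ∀ x → Anc root x
      treeEdges  : ∀ i → parT i ≡ root ⊎ Σ (Fin n) (λ j → parT i ≡ old j × Adj i j)
      ancDesc    : ∀ i j → Adj i j → Anc (old i) (old j) ⊎ Anc (old j) (old i)

  record ValidInsertions : Set where
    field
      noRoot₁  : ∀ a b → (a , b) ∈ ins → a ≢ root
      noRoot₂  : ∀ a b → (a , b) ∈ ins → b ≢ root
      distinct : ∀ a b → (a , b) ∈ ins → a ≢ b
      fresh    : ∀ i j → (old i , old j) ∈ ins → ¬ Adj i j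

  -- "|P| ≥ s": some s distinct vertices satisfy P
  AtLeast : ℕ → (V → Set) → Set
  AtLeast s P = Σ (Fin s → V) (λ f → Injective _≡_ _≡_ f × (∀ i → P (f i)))

  Big : V → Set
  Big x = AtLeast ⌈log₂ n ⌉ (Anc x)

  -- connected components of (original) T minus M0
  Allowed : (V → Set) → V → Set
  Allowed M0 a = ¬ M0 a × ¬ IsNew a

  TreeEdge : V → V → Set
  TreeEdge a b = par a ≡ just b ⊎ par b ≡ just a

  Comp : (V → Set) → V → V → Set
  Comp M0 = Star (λ a b → Allowed M0 a × Allowed M0 b × TreeEdge a b)

  SmallComponents : (V → Set) → Set
  SmallComponents M0 =
    ∀ y → Allowed M0 y → ¬ AtLeast (suc ⌊log₂ n ⌋) (Comp M0 y)

  InM : (V → Set) → V → Set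
  InM M0 x = M0 x × Big x

  -- The algorithm (relational big-step semantics; all nondeterministic
  -- choices – the order of iterating over L(w_i) and the edge returned
  -- by Q among valid answers – are left open).

  OnPath : V → V → V → Set
  OnPath u v y = Anc u y × Anc y v

  QHit : V → V → V → V → V → Set
  QHit x u v y z =
    OnPath u v y × Anc x z × E y z ×
    (∀ y' z' → OnPath u v y' → Anc x z' → E y' z' → Anc y y')

  QNull : V → V → V → Set
  QNull x u v = ∀ y z → OnPath u v y → Anc x z → ¬ E y z

  children : V → List V
  children w = filter (λ c → MaybeP.≡-dec _≟V_ (par c) (just w)) allV

  -- the subtrees queried for the path w₁ … w_t
  targets : List V → List V
  targets []             = []
  targets (w ∷ [])       = children w
  targets (w ∷ w' ∷ ws)  =
    filter (λ c → ¬? (c ≟V w')) (children w) ++ targets (w' ∷ ws)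

  addL : (V → List V) → V → V → (V → List V)
  addL L y z w = if ⌊ w ≟V y ⌋ then L w ++ (z ∷ []) else L w

  mark : (V → Bool) → List V → (V → Bool)
  mark vis ws w = vis w ∨ any (λ a → ⌊ w ≟V a ⌋) ws

  record State : Set where
    constructor st
    field
      vis : V → Bool
      L   : V → List V
  open State

  -- a query Q(T(x),u,v) is logged as (x , u , v)
  Query : Set
  Query = V × V × V

  -- Climb vis v u ws : u is obtained from v by going up while the parent
  -- exists and is unvisited; ws = path(u,v) listed from u down to v
  data Climb (vis : V → Bool) : V → V → List V → Set where
    stop : ∀ {v} → (par v ≡ nothing ⊎ Σ V (λ p → par v ≡ just p × vis p ≡ true))
         → Climb vis v v (v ∷ [])
    up   : ∀ {v p u ws} → par v ≡ just p → vis p ≡ false → Climb vis p u ws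
         → Climb vis v u (ws ++ v ∷ [])

  data Queries (u v : V) : (V → List V) → List V → (V → List V) → Set where
    qdone : ∀ {L} → Queries u v L [] L
    qnull : ∀ {L x xs L'} → QNull x u v → Queries u v L xs L'
          → Queries u v L (x ∷ xs) L'
    qhit  : ∀ {L x xs L' y z} → QHit x u v y z → Queries u v (addL L y z) xs L'
          → Queries u v L (x ∷ xs) L'

  -- DFS s v s' qs : the call DFS(v) started in state s ends in state s'
  -- and makes the queries qs
  data DFS  : State → V → State → List Query → Set
  data Loop : State → List V → State → List Query → Set
  data Iter : State → List V → State → List Query → Set

  data DFS where
    dfs : ∀ {s v u ws L₁ s' qs}
        → Climb (vis s) v u ws
        → Queries u v (L s) (targets ws) L₁
        → Loop (st (mark (vis s) ws) L₁) ws s' qs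
        → DFS s v s' (map (λ x → x , u , v) (targets ws) ++ qs)

  -- for i = 1..t : for each x ∈ L(w_i) (in any order)
  data Loop where
    ldone : ∀ {s} → Loop s [] s []
    lstep : ∀ {s w ws xs s₁ q₁ s₂ q₂}
          → xs ↭ L s w → Iter s xs s₁ q₁ → Loop s₁ ws s₂ q₂
          → Loop s (w ∷ ws) s₂ (q₁ ++ q₂)

  data Iter where
    inil  : ∀ {s} → Iter s [] s []
    iskip : ∀ {s x xs s' q} → vis s x ≡ true → Iter s xs s' q
          → Iter s (x ∷ xs) s' q
    icall : ∀ {s x xs s₁ q₁ s₂ q₂} → vis s x ≡ false → DFS s x s₁ q₁
          → Iter s₁ xs s₂ q₂ → Iter s (x ∷ xs) s₂ (q₁ ++ q₂)

  L₀ : V → List V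
  L₀ = foldr (λ e L → addL (addL L (proj₁ e) (proj₂ e))
                           (proj₂ e) (proj₁ e))
             (λ _ → []) ins

  Run : State → List Query → Set
  Run s' qs = DFS (st (λ _ → false) L₀) root s' qs

  InX : (V → Set) → List Query → V → Set
  InX M0 qs x = Σ V λ u → Σ V λ v → Σ V λ p → Σ V λ m →
    (x , u , v) ∈ qs × Big x × par x ≡ just p × InM M0 m × Anc u m × Anc m p

-- Every query Q(T(x),u,v) made during the run hangs off its path: par(x) lies on
-- path(u,v) but x does not. Since each DFS call marks its path visited, the paths of
-- two queries either coincide or are vertex-disjoint. Now let x₁ be a proper ancestor
-- of x₂, and m ∈ M lie on path(u₂, par(x₂)). If x₁ were strictly below m, then both
-- x₁ and par(x₁) would lie on path(u₂,v₂); as par(x₁) also lies on the path of the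
-- query at x₁, the two paths coincide, so x₁ would lie on its own query path. Hence
-- x₁ is an ancestor of m, and m ∈ path(x₁,x₂).
module Submission where

open import Defs
open import Data.Bool using (Bool; true; false; _∨_)
open import Data.Bool.Properties using (∨-zeroʳ; T-≡)
open import Data.Bool.ListAction using (any)
open import Data.Empty using (⊥-elim)
open import Data.List using (List; []; _∷_; _++_; map; filter)
open import Data.List.Membership.Propositional using (_∈_; _∉_)
open import Data.List.Membership.Propositional.Properties using (∈-++⁻; ∈-map⁻; ∈-filter⁻)
import Data.List.Relation.Unary.Any as Any
open import Data.List.Relation.Unary.Any.Properties using (any⁺)
open import Data.Maybe using (just)
import Data.Maybe.Properties as Maybe
open import Data.Nat using (ℕ; suc; _≤_)
open import Data.Nat.Properties using (≤-refl; ≤-trans; n≤1+n; <-irrefl)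
open import Data.Product using (Σ; _×_; _,_; proj₁; proj₂; map₁; map₂)
open import Data.Sum using (_⊎_; inj₁; inj₂; [_,_]′)
open import Function.Bundles using (module Equivalence)
open import Relation.Nullary using (¬_; ¬?; yes; no)
open import Relation.Nullary.Decidable using (⌊_⌋; fromWitness)
open import Relation.Binary.PropositionalEquality

module Ancestry (S : Setup) where

  anc-trans : ∀ {a b c} → Anc S a b → Anc S b c → Anc S a c
  anc-trans a≤b here           = a≤b
  anc-trans a≤b (there e b≤p) = there e (anc-trans a≤b b≤p)

  anc-parent : ∀ {b p} → par S b ≡ just p → Anc S p b
  anc-parent e = there e here

  par-unique : ∀ {b p p'} → par S b ≡ just p → par S b ≡ just p' → p ≡ p'
  par-unique e e' = Maybe.just-injective (trans (sym e) e')

  anc-par : ∀ {a b p} → Anc S a b → a ≢ b → par S b ≡ just p → Anc S a p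
  anc-par here         a≢b _  = ⊥-elim (a≢b refl)
  anc-par (there e a≤p) _   e' with par-unique e e'
  ... | refl = a≤p

  anc-linear : ∀ {a b c} → Anc S a c → Anc S b c → Anc S a b ⊎ Anc S b a
  anc-linear here           b≤c            = inj₂ b≤c
  anc-linear (there e a≤p)  here           = inj₁ (there e a≤p)
  anc-linear (there e a≤p)  (there e' b≤p') with par-unique e e'
  ... | refl = anc-linear a≤p b≤p'

module Rooted (S : Setup) (rooted : ∀ x → Anc S root x) where
  open Ancestry S

  anc-length : ∀ {a b} → Anc S a b → ℕ
  anc-length here        = 0
  anc-length (there _ d) = suc (anc-length d)

  anc-length-unique : ∀ {x} (d d' : Anc S root x) → anc-length d ≡ anc-length d'
  anc-length-unique here         here           = refl
  anc-length-unique here         (there () _)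
  anc-length-unique (there () _) here
  anc-length-unique (there e d)  (there e' d') with par-unique e e'
  ... | refl = cong suc (anc-length-unique d d')

  depth : V S → ℕ
  depth x = anc-length (rooted x)

  depth-par : ∀ {x p} → par S x ≡ just p → depth x ≡ suc (depth p)
  depth-par {x} {p} e = anc-length-unique (rooted x) (there e (rooted p))

  anc⇒depth≤ : ∀ {a b} → Anc S a b → depth a ≤ depth b
  anc⇒depth≤ here = ≤-refl
  anc⇒depth≤ (there {c = p} e a≤p) =
    ≤-trans (anc⇒depth≤ a≤p) (subst (depth p ≤_) (sym (depth-par e)) (n≤1+n _))

  par-not-below : ∀ {x p} → par S x ≡ just p → ¬ Anc S x p
  par-not-below e x≤p = <-irrefl refl (subst (_≤ _) (depth-par e) (anc⇒depth≤ x≤p))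

  anc-antisym : ∀ {a b} → Anc S a b → Anc S b a → a ≡ b
  anc-antisym here          _   = refl
  anc-antisym (there e a≤p) b≤a = ⊥-elim (par-not-below e (anc-trans b≤a a≤p))

module BatchInsertRun (S : Setup) (rooted : ∀ x → Anc S root x) where
  open Ancestry S
  open Rooted S rooted

  data DownPath : V S → V S → List (V S) → Set where
    end  : ∀ {v} → DownPath v v (v ∷ [])
    down : ∀ {w w' v ws} → par S w' ≡ just w → DownPath w' v (w' ∷ ws)
         → DownPath w v (w ∷ w' ∷ ws)

  downPath-snoc : ∀ {u p v ws} → DownPath u p ws → par S v ≡ just p
                → DownPath u v (ws ++ v ∷ [])
  downPath-snoc end        e = down e end
  downPath-snoc (down e' π) e = down e' (downPath-snoc π e)

  climb⇒downPath : ∀ {vis v u ws} → Climb S vis v u ws → DownPath u v ws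
  climb⇒downPath (stop _)   = end
  climb⇒downPath (up e _ c) = downPath-snoc (climb⇒downPath c) e

  downPath⇒anc : ∀ {u v ws} → DownPath u v ws → Anc S u v
  downPath⇒anc end        = here
  downPath⇒anc (down e π) = anc-trans (anc-parent e) (downPath⇒anc π)

  ∈downPath⇒onPath : ∀ {u v ws y} → DownPath u v ws → y ∈ ws → OnPath S u v y
  ∈downPath⇒onPath end        (Any.here refl) = here , here
  ∈downPath⇒onPath π@(down _ _) (Any.here refl) = here , downPath⇒anc π
  ∈downPath⇒onPath (down e π) (Any.there y∈ws) with ∈downPath⇒onPath π y∈ws
  ... | w'≤y , y≤v = anc-trans (anc-parent e) w'≤y , y≤v

  onPath⇒∈downPath : ∀ {u v ws y} → DownPath u v ws → OnPath S u v y → y ∈ ws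
  onPath⇒∈downPath end (u≤y , y≤u) = Any.here (anc-antisym y≤u u≤y)
  onPath⇒∈downPath {y = y} (down {w} {w'} e π) (w≤y , y≤v) with y ≟V w | y ≟V w'
  ... | yes refl | _        = Any.here refl
  ... | no _     | yes refl = Any.there (onPath⇒∈downPath π (here , y≤v))
  ... | no y≢w   | no y≢w' with anc-linear (downPath⇒anc π) y≤v
  ...   | inj₁ w'≤y = Any.there (onPath⇒∈downPath π (w'≤y , y≤v))
  ...   | inj₂ y≤w' = ⊥-elim (y≢w (anc-antisym (anc-par y≤w' y≢w' e) w≤y))

  climb-unvisited : ∀ {vis v u ws} → Climb S vis v u ws → vis v ≡ false
                  → ∀ {y} → y ∈ ws → vis y ≡ false
  climb-unvisited (stop _) v-unvisited (Any.here refl) = v-unvisited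
  climb-unvisited (up {ws = ws} _ p-unvisited c) v-unvisited y∈ws with ∈-++⁻ ws y∈ws
  ... | inj₁ y∈ws'             = climb-unvisited c p-unvisited y∈ws'
  ... | inj₂ (Any.here refl)   = v-unvisited

  children-par : ∀ {w x} → x ∈ children S w → par S x ≡ just w
  children-par {w} x∈ =
    proj₂ (∈-filter⁻ (λ c → Maybe.≡-dec _≟V_ (par S c) (just w)) {xs = allV} x∈)

  ∈-siblings : ∀ {w w' x} → x ∈ filter (λ c → ¬? (c ≟V w')) (children S w)
             → par S x ≡ just w × x ≢ w'
  ∈-siblings {w} {w'} x∈ with ∈-filter⁻ (λ c → ¬? (c ≟V w')) {xs = children S w} x∈
  ... | x∈children , x≢w' = children-par x∈children , x≢w'

  targets-par : ∀ ws {x} → x ∈ targets S ws → Σ (V S) λ p → par S x ≡ just p × p ∈ ws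
  targets-par (w ∷ [])      x∈ = w , children-par x∈ , Any.here refl
  targets-par (w ∷ w' ∷ ws) x∈ =
    [ (λ x∈siblings → w , proj₁ (∈-siblings x∈siblings) , Any.here refl)
    , (λ x∈rest → map₂ (map₂ Any.there) (targets-par (w' ∷ ws) x∈rest)) ]′
    (∈-++⁻ (filter (λ c → ¬? (c ≟V w')) (children S w)) x∈)

  targets-off-path : ∀ {u v ws x} → DownPath u v ws → x ∈ targets S ws → x ∉ ws
  targets-off-path end x∈ (Any.here refl) = par-not-below (children-par x∈) here
  targets-off-path (down {w} {w'} e π) x∈ x∈path
    with ∈-++⁻ (filter (λ c → ¬? (c ≟V w')) (children S w)) x∈ | x∈path
  ... | inj₁ x∈siblings | Any.here refl =
    par-not-below (proj₁ (∈-siblings x∈siblings)) here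
  ... | inj₁ x∈siblings | Any.there x∈π with ∈-siblings x∈siblings
  ...   | par-x , x≢w' =
    par-not-below e (anc-par (proj₁ (∈downPath⇒onPath π x∈π)) (≢-sym x≢w') par-x)
  targets-off-path (down {ws = ws} e π) x∈ x∈path | inj₂ x∈rest | Any.here refl
    with targets-par (_ ∷ ws) x∈rest
  ... | p , par-x , p∈π =
    par-not-below par-x (anc-trans (anc-parent e) (proj₁ (∈downPath⇒onPath π p∈π)))
  targets-off-path (down e π) x∈ x∈path | inj₂ x∈rest | Any.there x∈π =
    targets-off-path π x∈rest x∈π

  OnQueryPath : Query S → V S → Set
  OnQueryPath (_ , u , v) = OnPath S u v

  SamePath : Query S → Query S → Set
  SamePath (_ , u , v) (_ , u' , v') = u ≡ u' × v ≡ v'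

  Hanging : Query S → Set
  Hanging (x , u , v) =
    Σ (V S) (λ p → par S x ≡ just p × OnPath S u v p) × ¬ OnPath S u v x

  targets-hanging : ∀ {u v ws x} → DownPath u v ws → x ∈ targets S ws → Hanging (x , u , v)
  targets-hanging {ws = ws} π x∈ with targets-par ws x∈
  ... | p , par-x , p∈π =
    (p , par-x , ∈downPath⇒onPath π p∈π) ,
    λ x-on → targets-off-path π x∈ (onPath⇒∈downPath π x-on)

  visited : State S → V S → Bool
  visited = State.vis

  record QueryLog (s s' : State S) (qs : List (Query S)) : Set where
    field
      visited-mono  : ∀ y → visited s y ≡ true → visited s' y ≡ true
      hanging       : ∀ {q} → q ∈ qs → Hanging q
      path-fresh    : ∀ {q} → q ∈ qs → ∀ y → OnQueryPath q y
                    → visited s y ≡ false × visited s' y ≡ true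
      path-disjoint : ∀ {q q'} → q ∈ qs → q' ∈ qs → ∀ y → OnQueryPath q y → OnQueryPath q' y
                    → SamePath q q'
  open QueryLog

  queryLog-[] : ∀ {s} → QueryLog s s []
  queryLog-[] = record
    { visited-mono = λ _ t → t ; hanging = λ () ; path-fresh = λ () ; path-disjoint = λ () }

  queryLog-++ : ∀ {s₀ s₁ s₂ qs₁ qs₂} → QueryLog s₀ s₁ qs₁ → QueryLog s₁ s₂ qs₂
              → QueryLog s₀ s₂ (qs₁ ++ qs₂)
  queryLog-++ {s₀} {s₁} {s₂} {qs₁} {qs₂} I J = record
    { visited-mono  = λ y t → visited-mono J y (visited-mono I y t)
    ; hanging       = λ q∈ → [ hanging I , hanging J ]′ (∈-++⁻ qs₁ q∈)
    ; path-fresh    = fresh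
    ; path-disjoint = disjoint
    }
    where
      unvisited-before : ∀ y → visited s₁ y ≡ false → visited s₀ y ≡ false
      unvisited-before y f with visited s₀ y in e
      ... | false = refl
      ... | true  = trans (sym (visited-mono I y e)) f

      fresh : ∀ {q} → q ∈ qs₁ ++ qs₂ → ∀ y → OnQueryPath q y
            → visited s₀ y ≡ false × visited s₂ y ≡ true
      fresh q∈ y y-on with ∈-++⁻ qs₁ q∈
      ... | inj₁ q∈₁ = map₂ (visited-mono J y) (path-fresh I q∈₁ y y-on)
      ... | inj₂ q∈₂ = map₁ (unvisited-before y) (path-fresh J q∈₂ y y-on)

      -- a vertex on a path of qs₁ is visited in s₁, one on a path of qs₂ is not
      apart : ∀ {q q'} → q ∈ qs₁ → q' ∈ qs₂ → ∀ y → OnQueryPath q y → ¬ OnQueryPath q' y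
      apart q∈ q'∈ y y-on y-on' with
        trans (sym (proj₂ (path-fresh I q∈ y y-on))) (proj₁ (path-fresh J q'∈ y y-on'))
      ... | ()

      disjoint : ∀ {q q'} → q ∈ qs₁ ++ qs₂ → q' ∈ qs₁ ++ qs₂ → ∀ y
               → OnQueryPath q y → OnQueryPath q' y → SamePath q q'
      disjoint q∈ q'∈ y y-on y-on' with ∈-++⁻ qs₁ q∈ | ∈-++⁻ qs₁ q'∈
      ... | inj₁ q∈₁ | inj₁ q'∈₁ = path-disjoint I q∈₁ q'∈₁ y y-on y-on'
      ... | inj₂ q∈₂ | inj₂ q'∈₂ = path-disjoint J q∈₂ q'∈₂ y y-on y-on'
      ... | inj₁ q∈₁ | inj₂ q'∈₂ = ⊥-elim (apart q∈₁ q'∈₂ y y-on y-on')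
      ... | inj₂ q∈₂ | inj₁ q'∈₁ = ⊥-elim (apart q'∈₁ q∈₂ y y-on' y-on)

  marked-∈ : ∀ {vis : V S → Bool} {ws y} → y ∈ ws → mark S vis ws y ≡ true
  marked-∈ {vis} {ws} {y} y∈ws = trans (cong (vis y ∨_) y-listed) (∨-zeroʳ (vis y))
    where
      y-listed : any (λ a → ⌊ y ≟V a ⌋) ws ≡ true
      y-listed = Equivalence.to T-≡ (any⁺ _ (Any.map (λ { refl → fromWitness refl }) y∈ws))

  queryLog-call : ∀ {s v u ws L₁} → Climb S (visited s) v u ws → visited s v ≡ false
                → QueryLog s (st (mark S (visited s) ws) L₁) (map (λ x → x , u , v) (targets S ws))
  queryLog-call {s} {v} {u} {ws} c v-unvisited = record
    { visited-mono  = λ _ t → cong (_∨ _) t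
    ; hanging       = hang
    ; path-fresh    = fresh
    ; path-disjoint = λ q∈ q'∈ _ _ _ → same q∈ q'∈
    }
    where
      π = climb⇒downPath c
      qs = map (λ x → x , u , v) (targets S ws)

      hang : ∀ {q} → q ∈ qs → Hanging q
      hang q∈ with ∈-map⁻ _ q∈
      ... | _ , x∈ , refl = targets-hanging π x∈

      fresh : ∀ {q} → q ∈ qs → ∀ y → OnQueryPath q y
            → visited s y ≡ false × mark S (visited s) ws y ≡ true
      fresh q∈ y y-on with ∈-map⁻ _ q∈
      ... | _ , _ , refl =
        let y∈ws = onPath⇒∈downPath π y-on
        in climb-unvisited c v-unvisited y∈ws , marked-∈ {visited s} y∈ws

      same : ∀ {q q'} → q ∈ qs → q' ∈ qs → SamePath q q'
      same q∈ q'∈ with ∈-map⁻ _ q∈ | ∈-map⁻ _ q'∈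
      ... | _ , _ , refl | _ , _ , refl = refl , refl

  dfs-queryLog  : ∀ {s v s' qs} → DFS S s v s' qs → visited s v ≡ false → QueryLog s s' qs
  loop-queryLog : ∀ {s ws s' qs} → Loop S s ws s' qs → QueryLog s s' qs
  iter-queryLog : ∀ {s xs s' qs} → Iter S s xs s' qs → QueryLog s s' qs

  dfs-queryLog (dfs c _ loop) v-unvisited =
    queryLog-++ (queryLog-call c v-unvisited) (loop-queryLog loop)
  loop-queryLog ldone                 = queryLog-[]
  loop-queryLog (lstep _ iter loop)   = queryLog-++ (iter-queryLog iter) (loop-queryLog loop)
  iter-queryLog inil                  = queryLog-[]
  iter-queryLog (iskip _ iter)        = iter-queryLog iter
  iter-queryLog (icall x-unvisited call iter) =
    queryLog-++ (dfs-queryLog call x-unvisited) (iter-queryLog iter)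

  logged-off-path : ∀ {s s' qs x u v x' u' v' p} → QueryLog s s' qs
                  → (x , u , v) ∈ qs → (x' , u' , v') ∈ qs
                  → par S x ≡ just p → OnPath S u' v' p → ¬ OnPath S u' v' x
  logged-off-path {p = p} log q∈ q'∈ par-x p-on' x-on'
    with hanging log q∈
  ... | (p₁ , par-x₁ , p₁-on) , x-off with par-unique par-x par-x₁
  ... | refl with path-disjoint log q∈ q'∈ p p₁-on p-on'
  ... | refl , refl = x-off x-on'

  queried-ancestor-above-path : ∀ {s s' qs x₁ u₁ v₁ x₂ u₂ v₂ p₂ m} → QueryLog s s' qs
    → (x₁ , u₁ , v₁) ∈ qs → (x₂ , u₂ , v₂) ∈ qs
    → x₁ ≢ x₂ → Anc S x₁ x₂ → par S x₂ ≡ just p₂ → Anc S u₂ m → Anc S m p₂ → Anc S x₁ m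
  queried-ancestor-above-path log q₁∈ q₂∈ x₁≢x₂ x₁≤x₂ par-x₂ u₂≤m m≤p₂
    with anc-linear (anc-par x₁≤x₂ x₁≢x₂ par-x₂) m≤p₂
  ... | inj₁ x₁≤m = x₁≤m
  ... | inj₂ here = here
  ... | inj₂ (there par-x₁ m≤p₁) with hanging log q₂∈
  ... | (p₂' , par-x₂' , _ , p₂≤v₂) , _ with par-unique par-x₂ par-x₂'
  ... | refl = ⊥-elim (logged-off-path log q₁∈ q₂∈ par-x₁
                         (anc-trans u₂≤m m≤p₁ , anc-trans p₁≤p₂ p₂≤v₂)
                         (anc-trans u₂≤m (there par-x₁ m≤p₁) , anc-trans x₁≤p₂ p₂≤v₂))
    where
      x₁≤p₂ = anc-par x₁≤x₂ x₁≢x₂ par-x₂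
      p₁≤p₂ = anc-trans (anc-parent par-x₁) x₁≤p₂

lemma11 : (S : Setup)
    → (∀ i j → Setup.Adj S i j → Setup.Adj S j i)
    → (∀ i → ¬ Setup.Adj S i i)
    → IsDFSTree S
    → ValidInsertions S
    → (M0 : V S → Set)
    → (∀ v → M0 v → ¬ IsNew v)
    → SmallComponents S M0
    → (s' : State S) (qs : List (Query S))
    → Run S s' qs
    → (x₁ x₂ : V S)
    → InX S M0 qs x₁
    → InX S M0 qs x₂
    → x₁ ≢ x₂
    → Anc S x₁ x₂
    → Σ (V S) (λ m → InM S M0 m × Anc S x₁ m × Anc S m x₂)
lemma11 S _ _ dfsTree _ _ _ _ _ _ run _ _
  (_ , _ , _ , _ , q₁∈ , _) (_ , _ , _ , m , q₂∈ , _ , par-x₂ , m∈M , u₂≤m , m≤p₂) x₁≢x₂ x₁≤x₂ =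
  m , m∈M ,
  queried-ancestor-above-path (dfs-queryLog run refl) q₁∈ q₂∈ x₁≢x₂ x₁≤x₂ par-x₂ u₂≤m m≤p₂ ,
  anc-trans m≤p₂ (anc-parent par-x₂)
  where
    open Ancestry S
    open BatchInsertRun S (IsDFSTree.spanning dfsTree)
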